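{- Let $\mathcal{R}$ be a representable signature and $s$ a well-typed representable term over $\mathcal{R}$. If $s \to_\beta s'$ then $|s'| < |s|$; if $s \to_\eta s'$ then $\eta(s') < \eta(s)$.
   Context: A representable signature consists of a set $\mathcal{A}$ of atoms and a multigraph $\mathcal{R}$ whose nodes (types) are generated by $a ::= o \in \mathcal{A} \mid (a_1 \otimes \cdots \otimes a_k)$ for $k \in \mathbb{N}$, with sets $\mathcal{R}(a_1,\dots,a_n;b)$ of multiarrows. Representable terms: $s,t ::= x \mid \langle s_1,\dots,s_k\rangle \mid s[x_1^{a_1},\dots,x_k^{a_k} := t] \mid f(s_1,\dots,s_n)$; in $s[\vec{x} := t]$ the $x_i$ are bound in $s$; terms up to renaming of bound variables. Typing rules: $x:a \vdash x:a$; if $f \in \mathcal{R}(a_1,\dots,a_n;b)$ and $\gamma_i \vdash s_i : a_i$ then $\gamma_1,\dots,\gamma_n \vdash f(s_1,\dots,s_n) : b$; if $\gamma_i \vdash s_i : a_i$ then $\gamma_1,\dots,\gamma_k \vdash \langle s_1,\dots,s_k\rangle : (a_1\otimes\cdots\otimes a_k)$; if $\gamma \vdash t : (a_1 \otimes\cdots\otimes a_k)$ and $\delta, x_1:a_1,\dots,x_k:a_k, \delta' \vdash s : b$ then $\delta,\gamma,\delta' \vdash s[x_1^{a_1},\dots,x_k^{a_k} := t] : b$; combined contexts are disjoint (lists of distinct variables). Each typed term has a unique derivation, so each subterm occurrence has a typing judgment. Contexts with one hole: $\mathtt{C} ::= [\cdot] \mid \langle s_1,\dots,\mathtt{C},\dots,s_k\rangle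 \mid \mathtt{C}[\vec{x}:=t] \mid s[\vec{x} := \mathtt{C}] \mid f(s_1,\dots,\mathtt{C},\dots,s_n)$; $\mathtt{E}$ has the same grammar except that the clause $s[\vec{x} := \mathtt{E}]$ requires $\mathtt{E} \neq [\cdot]$; $\mathtt{L} ::= [\cdot] \mid \mathtt{L}[\vec{x} := t]$. $\mathsf{LT}$ is the set of terms $\mathtt{L}[\langle s_1,\dots,s_k\rangle]$. $\beta$: $s[x_1,\dots,x_k := \mathtt{L}[\langle t_1,\dots,t_k\rangle]] \to_\beta \mathtt{L}[s\{t_1/x_1,\dots,t_k/x_k\}]$ (capture-avoiding substitution), closed under $\mathtt{C}$-contexts. $\eta$: $s \to_\eta \langle x_1,\dots,x_k\rangle[x_1^{a_1},\dots,x_k^{a_k} := s]$ whenever $s$ has type $(a_1\otimes\cdots\otimes a_k)$, the $x_i$ are fresh and $s \notin \mathsf{LT}$; closed under $\mathtt{E}$-contexts. The size $|s|$ of a term is the number of syntactic constructors occurring in it. The size of a type: $|o| = 0$, $|(a_1\otimes\cdots\otimes a_k)| = 1 + \sum_i |a_i|$. For $\gamma \vdash s : a$, let $\mathsf{EST}(s)$ be the set of typed subterm occurrences $\delta \vdash p : b$ of $s$ with $p \notin \mathsf{LT}$ and $s = \mathtt{E}[p]$ for some $\mathtt{E}$-context; $\eta(s) = \sum_{(\delta \vdash p : b) \in \mathsf{EST}(s)} |b|$. -}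

module Defs where

open import Data.Nat using (ℕ; zero; suc; _+_)
open import Data.Bool using (if_then_else_)
open import Data.List using (List; []; _∷_; _++_; [_])
open import Data.List.Properties using (++-assoc; ++-identityʳ)
open import Data.Product using (Σ; _×_; _,_)
open import Relation.Binary.PropositionalEquality using (_≡_; refl; sym; trans; cong)
open import Relation.Nullary using (¬_; Dec; yes; no; does)

data Ty (At : Set) : Set where
  atom : At → Ty At
  ⊗    : List (Ty At) → Ty At

mutual
  tySize : {At : Set} → Ty At → ℕ
  tySize (atom o) = 0
  tySize (⊗ as)   = suc (tySizes as)

  tySizes : {At : Set} → List (Ty At) → ℕ
  tySizes []       = 0
  tySizes (a ∷ as) = tySize a + tySizes as

record Signature : Set₁ where
  field
    At : Set
    R  : List (Ty At) → Ty At → Set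

module _ {S : Signature} where
  open Signature S

  Type : Set
  Type = Ty At

  Ctx : Set
  Ctx = List Type

  -- Well-typed representable terms γ ⊢ s : a (intrinsically typed,
  -- nameless, ordered linear contexts; one constructor per typing rule).
  --   var a          :  x:a ⊢ x : a
  --   tup ss         :  γ₁,…,γₖ ⊢ ⟨s₁,…,sₖ⟩ : (a₁⊗⋯⊗aₖ)
  --   lett δ δ' cs s t : δ,γ,δ' ⊢ s[x₁^{c₁},…,xₖ^{cₖ} := t] : b
  --                    where δ,x₁:c₁,…,xₖ:cₖ,δ' ⊢ s : b and γ ⊢ t : (c₁⊗⋯⊗cₖ)
  --   app f ss       :  γ₁,…,γₙ ⊢ f(s₁,…,sₙ) : b
  -- Tms Γ as : a list of terms sᵢ with γᵢ ⊢ sᵢ : aᵢ and Γ = γ₁,…,γₙ.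

  mutual
    data Tm : Ctx → Type → Set where
      var  : (a : Type) → Tm [ a ] a
      tup  : ∀ {Γ as} → Tms Γ as → Tm Γ (⊗ as)
      lett : ∀ {γ b} (δ δ' cs : Ctx) → Tm (δ ++ cs ++ δ') b → Tm γ (⊗ cs)
           → Tm (δ ++ γ ++ δ') b
      app  : ∀ {Γ as b} → R as b → Tms Γ as → Tm Γ b

    data Tms : Ctx → List Type → Set where
      []  : Tms [] []
      _∷_ : ∀ {Γ Δ a as} → Tm Γ a → Tms Δ as → Tms (Γ ++ Δ) (a ∷ as)

  mutual
    size : ∀ {Γ a} → Tm Γ a → ℕ
    size (var a)            = 1
    size (tup ts)           = suc (sizes ts)
    size (lett δ δ' cs s t) = suc (size s + size t)
    size (app f ts)         = suc (sizes ts)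

    sizes : ∀ {Γ as} → Tms Γ as → ℕ
    sizes []       = 0
    sizes (t ∷ ts) = size t + sizes ts

  castTm : ∀ {Γ Δ a} → Γ ≡ Δ → Tm Γ a → Tm Δ a
  castTm refl t = t

  castTms : ∀ {Γ Δ as} → Γ ≡ Δ → Tms Γ as → Tms Δ as
  castTms refl t = t

  -- Simultaneous substitutions: a substitution for the (ordered, linear)
  -- context Γ with result context Δ is a Tms Δ Γ.

  _++ₜ_ : ∀ {Γ₁ Γ₂ as₁ as₂} → Tms Γ₁ as₁ → Tms Γ₂ as₂ → Tms (Γ₁ ++ Γ₂) (as₁ ++ as₂)
  [] ++ₜ us = us
  _++ₜ_ {Γ₂ = Γ₂} (_∷_ {Γ} {Δ} t ts) us =
    castTms (sym (++-assoc Γ Δ Γ₂)) (t ∷ (ts ++ₜ us))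

  idσ : (as : Ctx) → Tms as as
  idσ []       = []
  idσ (a ∷ as) = var a ∷ idσ as

  splitTms : ∀ {Δ} (Γ₁ Γ₂ : Ctx) → Tms Δ (Γ₁ ++ Γ₂) →
             Σ Ctx λ Δ₁ → Σ Ctx λ Δ₂ → Tms Δ₁ Γ₁ × Tms Δ₂ Γ₂ × (Δ₁ ++ Δ₂ ≡ Δ)
  splitTms [] Γ₂ σ = [] , _ , [] , σ , refl
  splitTms (a ∷ Γ₁) Γ₂ (_∷_ {Θ} t σ) with splitTms Γ₁ Γ₂ σ
  ... | Δ₁ , Δ₂ , σ₁ , σ₂ , eq =
    Θ ++ Δ₁ , Δ₂ , t ∷ σ₁ , σ₂ , trans (++-assoc Θ Δ₁ Δ₂) (cong (Θ ++_) eq)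

  mutual
    sub : ∀ {Γ Δ a} → Tm Γ a → Tms Δ Γ → Tm Δ a
    sub (var a) (_∷_ {Θ} t []) = castTm (sym (++-identityʳ Θ)) t
    sub (tup ts) σ = tup (subs ts σ)
    sub (app f ts) σ = app f (subs ts σ)
    sub (lett {γ = γ} δ δ' cs s t) σ with splitTms δ (γ ++ δ') σ
    ... | Δ₁ , Δ₂₃ , σ₁ , σ₂₃ , eq with splitTms γ δ' σ₂₃
    ... | Δ₂ , Δ₃ , σ₂ , σ₃ , eq' =
      castTm (trans (cong (Δ₁ ++_) eq') eq)
        (lett Δ₁ Δ₃ cs (sub s (σ₁ ++ₜ (idσ cs ++ₜ σ₃))) (sub t σ₂))

    subs : ∀ {Γ Δ as} → Tms Γ as → Tms Δ Γ → Tms Δ as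
    subs [] [] = []
    subs (_∷_ {Γ₁} {Γ₂} t ts) σ with splitTms Γ₁ Γ₂ σ
    ... | Δ₁ , Δ₂ , σ₁ , σ₂ , eq = castTms eq (sub t σ₁ ∷ subs ts σ₂)

  -- s{t₁/x₁,…,tₖ/xₖ} for the block x₁,…,xₖ sitting between δ and δ'
  substBlock : ∀ {δ δ' cs γ b} → Tm (δ ++ cs ++ δ') b → Tms γ cs → Tm (δ ++ γ ++ δ') b
  substBlock {δ} {δ'} s ts = sub s (idσ δ ++ₜ (ts ++ₜ idσ δ'))

  -- LT = { L[⟨s₁,…,sₖ⟩] },   L ::= [·] | L[x⃗ := t]

  data IsLT : ∀ {Γ a} → Tm Γ a → Set where
    lt-tup : ∀ {Γ as} {ts : Tms Γ as} → IsLT (tup ts)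
    lt-let : ∀ {γ b δ δ' cs} {s : Tm (δ ++ cs ++ δ') b} {t : Tm γ (⊗ cs)} →
             IsLT s → IsLT (lett δ δ' cs s t)

  isLT? : ∀ {Γ a} (s : Tm Γ a) → Dec (IsLT s)
  isLT? (var a) = no λ ()
  isLT? (tup ts) = yes lt-tup
  isLT? (lett δ δ' cs s t) with isLT? s
  ... | yes p = yes (lt-let p)
  ... | no ¬p = no λ { (lt-let p) → ¬p p }
  isLT? (app f ts) = no λ ()

  reassoc : (δ ε X ε' δ' : Ctx) →
            δ ++ (ε ++ X ++ ε') ++ δ' ≡ (δ ++ ε) ++ X ++ (ε' ++ δ')
  reassoc δ ε X ε' δ' =
    trans (cong (δ ++_) (trans (++-assoc ε (X ++ ε') δ')
                               (cong (ε ++_) (++-assoc X ε' δ'))))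
          (sym (++-assoc δ ε (X ++ ε' ++ δ')))

  -- Given s (with the block x⃗ : cs) and u = L[⟨t₁,…,tₖ⟩] ∈ LT,
  -- betaRoot s u computes L[s{t₁/x₁,…,tₖ/xₖ}].
  betaRoot : ∀ {δ δ' cs γ b} → Tm (δ ++ cs ++ δ') b → (u : Tm γ (⊗ cs)) → IsLT u
           → Tm (δ ++ γ ++ δ') b
  betaRoot s (var _) ()
  betaRoot s (app f ts) ()
  betaRoot {δ} {δ'} s (tup ts) lt-tup = substBlock {δ} {δ'} s ts
  betaRoot {δ} {δ'} s (lett {γ = ρ} ε ε' ds u r) (lt-let p) =
    castTm (sym (reassoc δ ε ρ ε' δ'))
      (lett (δ ++ ε) (ε' ++ δ') ds
         (castTm (reassoc δ ε ds ε' δ') (betaRoot {δ} {δ'} s u p)) r)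

  infix 4 _⟶β_ _⟶βs_ _⟶η_ _⟶η⁺_ _⟶ηs_

  mutual
    data _⟶β_ : ∀ {Γ a} → Tm Γ a → Tm Γ a → Set where
      β-root    : ∀ {δ δ' cs γ b} (s : Tm (δ ++ cs ++ δ') b) (u : Tm γ (⊗ cs))
                  (p : IsLT u) → lett δ δ' cs s u ⟶β betaRoot {δ} {δ'} s u p
      β-tup     : ∀ {Γ as} {ts ts' : Tms Γ as} → ts ⟶βs ts' → tup ts ⟶β tup ts'
      β-letBody : ∀ {δ δ' cs γ b} {s s' : Tm (δ ++ cs ++ δ') b} {t : Tm γ (⊗ cs)} →
                  s ⟶β s' → lett δ δ' cs s t ⟶β lett δ δ' cs s' t
      β-letArg  : ∀ {δ δ' cs γ b} {s : Tm (δ ++ cs ++ δ') b} {t t' : Tm γ (⊗ cs)} →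
                  t ⟶β t' → lett δ δ' cs s t ⟶β lett δ δ' cs s t'
      β-app     : ∀ {Γ as b} {f : R as b} {ts ts' : Tms Γ as} →
                  ts ⟶βs ts' → app f ts ⟶β app f ts'

    data _⟶βs_ : ∀ {Γ as} → Tms Γ as → Tms Γ as → Set where
      here  : ∀ {Γ Δ a as} {t t' : Tm Γ a} {ts : Tms Δ as} →
              t ⟶β t' → t ∷ ts ⟶βs t' ∷ ts
      there : ∀ {Γ Δ a as} {t : Tm Γ a} {ts ts' : Tms Δ as} →
              ts ⟶βs ts' → t ∷ ts ⟶βs t ∷ ts'

  -- η-expansion s ↦ ⟨x₁,…,xₖ⟩[x₁,…,xₖ := s] (x⃗ fresh), for s ∉ LT,
  -- closed under E-contexts (no step at the root of a let-argument).

  etaExp : ∀ {Γ as} → Tm Γ (⊗ as) → Tm Γ (⊗ as)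
  etaExp {Γ} {as} s =
    castTm (++-identityʳ Γ)
      (lett [] [] as (castTm (sym (++-identityʳ as)) (tup (idσ as))) s)

  mutual
    data _⟶η_ : ∀ {Γ a} → Tm Γ a → Tm Γ a → Set where
      η-root : ∀ {Γ as} {s : Tm Γ (⊗ as)} → ¬ IsLT s → s ⟶η etaExp s
      η-deep : ∀ {Γ a} {s s' : Tm Γ a} → s ⟶η⁺ s' → s ⟶η s'

    -- steps under an E-context different from [·]
    data _⟶η⁺_ : ∀ {Γ a} → Tm Γ a → Tm Γ a → Set where
      η-tup     : ∀ {Γ as} {ts ts' : Tms Γ as} → ts ⟶ηs ts' → tup ts ⟶η⁺ tup ts'
      η-letBody : ∀ {δ δ' cs γ b} {s s' : Tm (δ ++ cs ++ δ') b} {t : Tm γ (⊗ cs)} →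
                  s ⟶η s' → lett δ δ' cs s t ⟶η⁺ lett δ δ' cs s' t
      η-letArg  : ∀ {δ δ' cs γ b} {s : Tm (δ ++ cs ++ δ') b} {t t' : Tm γ (⊗ cs)} →
                  t ⟶η⁺ t' → lett δ δ' cs s t ⟶η⁺ lett δ δ' cs s t'
      η-app     : ∀ {Γ as b} {f : R as b} {ts ts' : Tms Γ as} →
                  ts ⟶ηs ts' → app f ts ⟶η⁺ app f ts'

    data _⟶ηs_ : ∀ {Γ as} → Tms Γ as → Tms Γ as → Set where
      here  : ∀ {Γ Δ a as} {t t' : Tm Γ a} {ts : Tms Δ as} →
              t ⟶η t' → _∷_ {Γ} {Δ} t ts ⟶ηs t' ∷ ts
      there : ∀ {Γ Δ a as} {t : Tm Γ a} {ts ts' : Tms Δ as} →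
              ts ⟶ηs ts' → t ∷ ts ⟶ηs t ∷ ts'

  -- η(s) = Σ_{(δ ⊢ p : b) ∈ EST(s)} |b|, computed by structural recursion
  -- following the grammar of E-contexts:
  --   eta s      : sum over occurrences p with s = E[p]
  --   etaInner s : sum over occurrences p with s = E[p], E ≠ [·]

  etaHere : ∀ {Γ a} → Tm Γ a → ℕ
  etaHere {a = a} s = if does (isLT? s) then 0 else tySize a

  mutual
    eta : ∀ {Γ a} → Tm Γ a → ℕ
    eta s = etaHere s + etaInner s

    etaInner : ∀ {Γ a} → Tm Γ a → ℕ
    etaInner (var a)            = 0
    etaInner (tup ts)           = etas ts
    etaInner (lett δ δ' cs s t) = eta s + etaInner t
    etaInner (app f ts)         = etas ts

    etas : ∀ {Γ as} → Tms Γ as → ℕ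
    etas []       = 0
    etas (t ∷ ts) = eta t + etas ts

-- β: contracting s[x⃗ := L[⟨t⃗⟩]] removes the let and the tuple and replaces
-- each variable xᵢ (size 1) by tᵢ, so substitution adds only Σ (|tᵢ| − 1)
-- constructors and the size drops.
-- η: in ⟨x⃗⟩[x⃗ := s] the let and the tuple are in LT, the fresh variables
-- contribute Σ |aᵢ|, and s itself, now a let-argument, no longer counts; so
-- η drops by |(a₁ ⊗ ⋯ ⊗ aₖ)| − Σ |aᵢ| = 1.  Deeper steps decrease η because
-- η-expansion keeps LT terms in LT, so no occurrence starts to count.
module Submission where

open import Defs
open import Data.Nat using (ℕ; suc; pred; _+_; _≤_; _<_; z≤n; s≤s; s<s)
open import Data.Nat.Properties
open import Data.Nat.Tactic.RingSolver using (solve-∀)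
open import Algebra.Properties.CommutativeSemigroup +-commutativeSemigroup using (interchange)
open import Data.List using ([]; _∷_; _++_)
open import Data.List.Properties using (++-assoc; ++-identityʳ)
open import Data.Product using (_×_; _,_)
open import Data.Empty using (⊥-elim)
open import Relation.Nullary using (¬_; yes; no)
open import Relation.Binary.PropositionalEquality

module _ {S : Signature} where

  size≡suc-pred : ∀ {Γ a} (t : Tm {S} Γ a) → size t ≡ suc (pred (size t))
  size≡suc-pred (var a)            = refl
  size≡suc-pred (tup ts)           = refl
  size≡suc-pred (lett δ δ' cs s t) = refl
  size≡suc-pred (app f ts)         = refl

  -- Every term has size ≥ 1, so excess σ is the sum of the sizes of σ minus
  -- its length: the number of constructors that substituting σ adds.
  excess : ∀ {Δ Γ} → Tms {S} Δ Γ → ℕ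
  excess []      = 0
  excess (t ∷ σ) = pred (size t) + excess σ

  size-castTm : ∀ {Γ Δ a} (eq : Γ ≡ Δ) (t : Tm {S} Γ a) → size (castTm eq t) ≡ size t
  size-castTm refl t = refl

  sizes-castTms : ∀ {Γ Δ as} (eq : Γ ≡ Δ) (ts : Tms {S} Γ as) → sizes (castTms eq ts) ≡ sizes ts
  sizes-castTms refl ts = refl

  excess-castTms : ∀ {Γ Δ as} (eq : Γ ≡ Δ) (σ : Tms {S} Γ as) → excess (castTms eq σ) ≡ excess σ
  excess-castTms refl σ = refl

  excess-++ₜ : ∀ {Γ₁ Γ₂ as₁ as₂} (σ₁ : Tms {S} Γ₁ as₁) (σ₂ : Tms {S} Γ₂ as₂) →
               excess (σ₁ ++ₜ σ₂) ≡ excess σ₁ + excess σ₂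
  excess-++ₜ []       σ₂ = refl
  excess-++ₜ {Γ₂ = Γ₂} (_∷_ {Γ} {Δ} t σ₁) σ₂ = begin
    excess ((t ∷ σ₁) ++ₜ σ₂)                    ≡⟨ excess-castTms (sym (++-assoc Γ Δ Γ₂)) (t ∷ (σ₁ ++ₜ σ₂)) ⟩
    pred (size t) + excess (σ₁ ++ₜ σ₂)          ≡⟨ cong (pred (size t) +_) (excess-++ₜ σ₁ σ₂) ⟩
    pred (size t) + (excess σ₁ + excess σ₂)     ≡⟨ +-assoc (pred (size t)) _ _ ⟨
    pred (size t) + excess σ₁ + excess σ₂       ∎
    where open ≡-Reasoning

  excess-idσ : (as : Ctx {S}) → excess (idσ {S} as) ≡ 0
  excess-idσ []       = refl
  excess-idσ (a ∷ as) = excess-idσ as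

  excess-splitTms : ∀ {Δ} (Γ₁ Γ₂ : Ctx {S}) (σ : Tms {S} Δ (Γ₁ ++ Γ₂)) →
    let (_ , _ , σ₁ , σ₂ , _) = splitTms Γ₁ Γ₂ σ in excess σ₁ + excess σ₂ ≡ excess σ
  excess-splitTms []       Γ₂ σ       = refl
  excess-splitTms (a ∷ Γ₁) Γ₂ (t ∷ σ) with splitTms Γ₁ Γ₂ σ | excess-splitTms Γ₁ Γ₂ σ
  ... | _ , _ , σ₁ , σ₂ , _ | split = trans (+-assoc (pred (size t)) _ _) (cong (pred (size t) +_) split)

  excess≤sizes : ∀ {Δ Γ} (σ : Tms {S} Δ Γ) → excess σ ≤ sizes σ
  excess≤sizes []      = z≤n
  excess≤sizes (t ∷ σ) = +-mono-≤ pred[n]≤n (excess≤sizes σ)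

  mutual
    size-sub : ∀ {Γ Δ a} (s : Tm {S} Γ a) (σ : Tms {S} Δ Γ) → size (sub s σ) ≡ size s + excess σ
    size-sub (var a) (_∷_ {Θ} t []) = begin
      size (castTm (sym (++-identityʳ Θ)) t) ≡⟨ size-castTm (sym (++-identityʳ Θ)) t ⟩
      size t                                 ≡⟨ size≡suc-pred t ⟩
      suc (pred (size t))                    ≡⟨ cong suc (+-identityʳ (pred (size t))) ⟨
      suc (pred (size t) + 0)                ∎
      where open ≡-Reasoning
    size-sub (tup ts)   σ = cong suc (sizes-subs ts σ)
    size-sub (app f ts) σ = cong suc (sizes-subs ts σ)
    size-sub (lett {γ = γ} δ δ' cs s t) σ
      with splitTms δ (γ ++ δ') σ | excess-splitTms δ (γ ++ δ') σ
    ... | Δ₁ , _ , σ₁ , σ₂₃ , eq | split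
      with splitTms γ δ' σ₂₃ | excess-splitTms γ δ' σ₂₃
    ... | _ , _ , σ₂ , σ₃ , eq' | split' = begin
      size (castTm _ (lett Δ₁ _ cs (sub s σ′) (sub t σ₂)))
        ≡⟨ size-castTm (trans (cong (Δ₁ ++_) eq') eq) (lett Δ₁ _ cs (sub s σ′) (sub t σ₂)) ⟩
      suc (size (sub s σ′) + size (sub t σ₂))
        ≡⟨ cong₂ (λ m n → suc (m + n)) (size-sub s σ′) (size-sub t σ₂) ⟩
      suc (size s + excess σ′ + (size t + excess σ₂))
        ≡⟨ cong (λ m → suc (size s + m + (size t + excess σ₂))) excess-σ′ ⟩
      suc (size s + (excess σ₁ + excess σ₃) + (size t + excess σ₂))
        ≡⟨ regroup (size s) (size t) (excess σ₁) (excess σ₂) (excess σ₃) ⟩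
      suc (size s + size t) + (excess σ₁ + (excess σ₂ + excess σ₃))
        ≡⟨ cong (suc (size s + size t) +_) (trans (cong (excess σ₁ +_) split') split) ⟩
      suc (size s + size t) + excess σ ∎
      where
      open ≡-Reasoning
      σ′ = σ₁ ++ₜ (idσ cs ++ₜ σ₃)
      excess-σ′ : excess σ′ ≡ excess σ₁ + excess σ₃
      excess-σ′ = begin
        excess σ′                                    ≡⟨ excess-++ₜ σ₁ (idσ cs ++ₜ σ₃) ⟩
        excess σ₁ + excess (idσ cs ++ₜ σ₃)           ≡⟨ cong (excess σ₁ +_) (excess-++ₜ (idσ cs) σ₃) ⟩
        excess σ₁ + (excess (idσ cs) + excess σ₃)    ≡⟨ cong (λ m → excess σ₁ + (m + excess σ₃)) (excess-idσ cs) ⟩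
        excess σ₁ + excess σ₃                        ∎
      regroup : ∀ m n e₁ e₂ e₃ → suc (m + (e₁ + e₃) + (n + e₂)) ≡ suc (m + n) + (e₁ + (e₂ + e₃))
      regroup = solve-∀

    sizes-subs : ∀ {Γ Δ as} (ts : Tms {S} Γ as) (σ : Tms {S} Δ Γ) → sizes (subs ts σ) ≡ sizes ts + excess σ
    sizes-subs [] [] = refl
    sizes-subs (_∷_ {Γ₁} {Γ₂} t ts) σ with splitTms Γ₁ Γ₂ σ | excess-splitTms Γ₁ Γ₂ σ
    ... | _ , _ , σ₁ , σ₂ , eq | split = begin
      sizes (castTms eq (sub t σ₁ ∷ subs ts σ₂))    ≡⟨ sizes-castTms eq (sub t σ₁ ∷ subs ts σ₂) ⟩
      size (sub t σ₁) + sizes (subs ts σ₂)          ≡⟨ cong₂ _+_ (size-sub t σ₁) (sizes-subs ts σ₂) ⟩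
      (size t + excess σ₁) + (sizes ts + excess σ₂) ≡⟨ interchange (size t) (excess σ₁) (sizes ts) (excess σ₂) ⟩
      (size t + sizes ts) + (excess σ₁ + excess σ₂) ≡⟨ cong (size t + sizes ts +_) split ⟩
      (size t + sizes ts) + excess σ                ∎
      where open ≡-Reasoning

  size-substBlock : ∀ {δ δ' cs γ b} (s : Tm {S} (δ ++ cs ++ δ') b) (ts : Tms {S} γ cs) →
                    size (substBlock {δ = δ} {δ'} s ts) ≡ size s + excess ts
  size-substBlock {δ} {δ'} s ts = begin
    size (sub s (idσ δ ++ₜ (ts ++ₜ idσ δ')))          ≡⟨ size-sub s (idσ δ ++ₜ (ts ++ₜ idσ δ')) ⟩
    size s + excess (idσ δ ++ₜ (ts ++ₜ idσ δ'))       ≡⟨ cong (size s +_) excess-block ⟩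
    size s + excess ts                               ∎
    where
    open ≡-Reasoning
    excess-block : excess (idσ δ ++ₜ (ts ++ₜ idσ δ')) ≡ excess ts
    excess-block = begin
      excess (idσ δ ++ₜ (ts ++ₜ idσ δ'))               ≡⟨ excess-++ₜ (idσ δ) (ts ++ₜ idσ δ') ⟩
      excess (idσ δ) + excess (ts ++ₜ idσ δ')          ≡⟨ cong₂ _+_ (excess-idσ δ) (excess-++ₜ ts (idσ δ')) ⟩
      excess ts + excess (idσ δ')                      ≡⟨ cong (excess ts +_) (excess-idσ δ') ⟩
      excess ts + 0                                    ≡⟨ +-identityʳ (excess ts) ⟩
      excess ts                                        ∎

  size-betaRoot : ∀ {δ δ' cs γ b} (s : Tm {S} (δ ++ cs ++ δ') b) (u : Tm {S} γ (⊗ cs)) (p : IsLT u) →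
                  size (betaRoot {δ = δ} {δ'} s u p) < size s + size u
  size-betaRoot {δ} {δ'} s (tup ts) lt-tup = begin-strict
    size (substBlock {δ = δ} {δ'} s ts) ≡⟨ size-substBlock {δ = δ} {δ'} s ts ⟩
    size s + excess ts                  <⟨ +-monoʳ-< (size s) (s≤s (excess≤sizes ts)) ⟩
    size s + size (tup ts)              ∎
    where open ≤-Reasoning
  size-betaRoot {δ} {δ'} s u′@(lett {γ = ρ} ε ε' ds u r) (lt-let p) = begin-strict
    size (betaRoot {δ = δ} {δ'} s u′ (lt-let p)) ≡⟨ size-castTm (sym (reassoc {S} δ ε ρ ε' δ')) (lett (δ ++ ε) (ε' ++ δ') ds b′ r) ⟩
    suc (size b′ + size r)                       ≡⟨ cong (λ m → suc (m + size r)) (size-castTm (reassoc {S} δ ε ds ε' δ') b) ⟩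
    suc (size b + size r)                        <⟨ s<s (+-monoˡ-< (size r) (size-betaRoot {δ} {δ'} s u p)) ⟩
    suc (size s + size u + size r)               ≡⟨ cong suc (+-assoc (size s) (size u) (size r)) ⟩
    suc (size s + (size u + size r))             ≡⟨ +-suc (size s) (size u + size r) ⟨
    size s + size u′                             ∎
    where
    open ≤-Reasoning
    b  = betaRoot {δ = δ} {δ'} s u p
    b′ = castTm (reassoc {S} δ ε ds ε' δ') b

  mutual
    size-⟶β : ∀ {Γ a} {s s' : Tm {S} Γ a} → s ⟶β s' → size s' < size s
    size-⟶β (β-root {δ} {δ'} s u p) = m<n⇒m<1+n (size-betaRoot {δ} {δ'} s u p)
    size-⟶β (β-tup r)                = s<s (sizes-⟶βs r)
    size-⟶β (β-letBody {t = t} r)    = s<s (+-monoˡ-< (size t) (size-⟶β r))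
    size-⟶β (β-letArg {s = s} r)     = s<s (+-monoʳ-< (size s) (size-⟶β r))
    size-⟶β (β-app r)                = s<s (sizes-⟶βs r)

    sizes-⟶βs : ∀ {Γ as} {ts ts' : Tms {S} Γ as} → ts ⟶βs ts' → sizes ts' < sizes ts
    sizes-⟶βs (here {ts = ts} r)  = +-monoˡ-< (sizes ts) (size-⟶β r)
    sizes-⟶βs (there {t = t} r)   = +-monoʳ-< (size t) (sizes-⟶βs r)

  etaHere-IsLT : ∀ {Γ a} {s : Tm {S} Γ a} → IsLT s → etaHere s ≡ 0
  etaHere-IsLT {s = s} p with isLT? s
  ... | yes _ = refl
  ... | no ¬p = ⊥-elim (¬p p)

  etaHere-¬IsLT : ∀ {Γ a} {s : Tm {S} Γ a} → ¬ IsLT s → etaHere s ≡ tySize a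
  etaHere-¬IsLT {s = s} ¬p with isLT? s
  ... | yes p = ⊥-elim (¬p p)
  ... | no _  = refl

  etaHere≤tySize : ∀ {Γ a} (s : Tm {S} Γ a) → etaHere s ≤ tySize a
  etaHere≤tySize s with isLT? s
  ... | yes _ = z≤n
  ... | no _  = ≤-refl

  IsLT-castTm : ∀ {Γ Δ a} (eq : Γ ≡ Δ) {t : Tm {S} Γ a} → IsLT t → IsLT (castTm eq t)
  IsLT-castTm refl p = p

  eta-castTm : ∀ {Γ Δ a} (eq : Γ ≡ Δ) (t : Tm {S} Γ a) → eta (castTm eq t) ≡ eta t
  eta-castTm refl t = refl

  etas-idσ : (as : Ctx {S}) → etas (idσ {S} as) ≡ tySizes as
  etas-idσ []       = refl
  etas-idσ (a ∷ as) = cong₂ _+_ (+-identityʳ (tySize a)) (etas-idσ as)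

  eta-etaExp : ∀ {Γ as} (s : Tm {S} Γ (⊗ as)) → eta (etaExp s) ≡ tySizes as + etaInner s
  eta-etaExp {Γ} {as} s = begin
    eta (castTm (++-identityʳ Γ) (lett [] [] as body s)) ≡⟨ eta-castTm (++-identityʳ Γ) (lett [] [] as body s) ⟩
    etaHere (lett [] [] as body s) + (eta body + etaInner s)
      ≡⟨ cong (_+ (eta body + etaInner s)) (etaHere-IsLT (lt-let (IsLT-castTm (sym (++-identityʳ as)) lt-tup))) ⟩
    eta body + etaInner s                                ≡⟨ cong (_+ etaInner s) eta-body ⟩
    tySizes as + etaInner s                              ∎
    where
    open ≡-Reasoning
    body = castTm {S} (sym (++-identityʳ as)) (tup (idσ as))
    eta-body : eta body ≡ tySizes as
    eta-body = trans (eta-castTm (sym (++-identityʳ as)) (tup (idσ as))) (etas-idσ as)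

  mutual
    IsLT-⟶η : ∀ {Γ a} {s s' : Tm {S} Γ a} → s ⟶η s' → IsLT s → IsLT s'
    IsLT-⟶η (η-root ¬p) p = ⊥-elim (¬p p)
    IsLT-⟶η (η-deep r)  p = IsLT-⟶η⁺ r p

    IsLT-⟶η⁺ : ∀ {Γ a} {s s' : Tm {S} Γ a} → s ⟶η⁺ s' → IsLT s → IsLT s'
    IsLT-⟶η⁺ (η-tup r)     lt-tup     = lt-tup
    IsLT-⟶η⁺ (η-letBody r) (lt-let p) = lt-let (IsLT-⟶η r p)
    IsLT-⟶η⁺ (η-letArg r)  (lt-let p) = lt-let p

  etaHere-⟶η⁺ : ∀ {Γ a} {s s' : Tm {S} Γ a} → s ⟶η⁺ s' → etaHere s' ≤ etaHere s
  etaHere-⟶η⁺ {s = s} {s'} r with isLT? s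
  ... | yes p = ≤-reflexive (etaHere-IsLT (IsLT-⟶η⁺ r p))
  ... | no _  = etaHere≤tySize s'

  mutual
    eta-⟶η : ∀ {Γ a} {s s' : Tm {S} Γ a} → s ⟶η s' → eta s' < eta s
    eta-⟶η (η-root {s = s} ¬p) rewrite eta-etaExp s | etaHere-¬IsLT ¬p = ≤-refl
    eta-⟶η (η-deep r)          = +-mono-≤-< (etaHere-⟶η⁺ r) (etaInner-⟶η⁺ r)

    etaInner-⟶η⁺ : ∀ {Γ a} {s s' : Tm {S} Γ a} → s ⟶η⁺ s' → etaInner s' < etaInner s
    etaInner-⟶η⁺ (η-tup r)             = etas-⟶ηs r
    etaInner-⟶η⁺ (η-letBody {t = t} r) = +-monoˡ-< (etaInner t) (eta-⟶η r)
    etaInner-⟶η⁺ (η-letArg {s = s} r)  = +-monoʳ-< (eta s) (etaInner-⟶η⁺ r)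
    etaInner-⟶η⁺ (η-app r)             = etas-⟶ηs r

    etas-⟶ηs : ∀ {Γ as} {ts ts' : Tms {S} Γ as} → ts ⟶ηs ts' → etas ts' < etas ts
    etas-⟶ηs (here {ts = ts} r) = +-monoˡ-< (etas ts) (eta-⟶η r)
    etas-⟶ηs (there {t = t} r)  = +-monoʳ-< (eta t) (etas-⟶ηs r)

proposition3p7 : (S : Signature) → ∀ {Γ a} (s s' : Tm {S} Γ a) →
                   (s ⟶β s' → size s' < size s) × (s ⟶η s' → eta s' < eta s)
proposition3p7 S s s' = size-⟶β , eta-⟶η
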